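{- If a sequence $\pi_1$ is a $\preceq$-contraction of a sequence $\pi_2$, and $\pi_2$ is a $\preceq$-contraction of a sequence $\pi_3$, then $\pi_1$ is a $\preceq$-contraction of $\pi_3$.
   Context: Fix $d\ge1$; all sequences are sequences of priorities from $\{1,\dots,d\}$. The order $\preceq$ on positive integers is $\dots\preceq5\preceq3\preceq1\preceq2\preceq4\preceq6\preceq\dots$. The leader of a finite sequence is its maximum, or $1$ if it is empty; a finite sequence fulfils $r$ if $r\preceq$ its leader. A finite sequence $r_1,\dots,r_k$ is a $\preceq$-contraction of a finite sequence $p_1,\dots,p_n$ if there are indices $0=i_0\le i_1\le\dots\le i_k=n$ such that for each $j\in\{1,\dots,k\}$ the (possibly empty) infix $p_{i_{j-1}+1},\dots,p_{i_j}$ fulfils $r_j$. An infinite sequence $r_1,r_2,\dots$ is a $\preceq$-contraction of an infinite sequence $p_1,p_2,\dots$ if there are infinitely many indices $0=i_0\le i_1\le i_2\le\dots$ tending to infinity such that for each $j\ge1$ the infix $p_{i_{j-1}+1},\dots,p_{i_j}$ fulfils $r_j$. -}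

module Defs where

open import Data.Nat using (ℕ; zero; suc; _+_; _∸_; _≤_; _<_; _⊔_; _%_)
open import Data.List using (List; []; _∷_; foldr; length; take; drop; map; upTo; lookup)
open import Data.List.Relation.Unary.All using (All)
open import Data.Fin using (Fin; toℕ)
open import Data.Product using (Σ; _×_; ∃)
open import Relation.Binary.PropositionalEquality using (_≡_)

Odd : ℕ → Set
Odd n = n % 2 ≡ 1

Even : ℕ → Set
Even n = n % 2 ≡ 0

data _⪯_ (m n : ℕ) : Set where
  odd⪯even : Odd m → Even n → m ⪯ n
  odd⪯odd  : Odd m → Odd n → n ≤ m → m ⪯ n
  even⪯even : Even m → Even n → m ≤ n → m ⪯ n

Prio : ℕ → ℕ → Set
Prio d p = 1 ≤ p × p ≤ d

leader : List ℕ → ℕ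
leader = foldr _⊔_ 1

Fulfils : List ℕ → ℕ → Set
Fulfils xs r = r ⪯ leader xs

-- Infix p_{a+1},…,p_b of a finite sequence p = p_1,…,p_n.
infixL : List ℕ → ℕ → ℕ → List ℕ
infixL p a b = drop a (take b p)

-- Finite ⪯-contraction: rs = r_1,…,r_k is a contraction of ps = p_1,…,p_n
-- if there are indices 0 = i_0 ≤ i_1 ≤ … ≤ i_k = n (given by i : ℕ → ℕ,
-- only values i 0,…,i k matter) such that p_{i_{j-1}+1},…,p_{i_j} fulfils r_j.
-- (r_j is  lookup rs j'  for j' = j - 1 : Fin k.)
FinContraction : List ℕ → List ℕ → Set
FinContraction rs ps =
  Σ (ℕ → ℕ) λ i →
    (i 0 ≡ 0) × (i (length rs) ≡ length ps) ×
    ((j : ℕ) → j < length rs → i j ≤ i (suc j)) ×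
    ((j : Fin (length rs)) →
       Fulfils (infixL ps (i (toℕ j)) (i (suc (toℕ j)))) (lookup rs j))

-- Infinite sequences p_1,p_2,… are functions ℕ → ℕ with p_{m+1} = p m.
-- Infix p_{a+1},…,p_b of an infinite sequence.
infixω : (ℕ → ℕ) → ℕ → ℕ → List ℕ
infixω p a b = map (λ k → p (a + k)) (upTo (b ∸ a))

-- Infinite ⪯-contraction: indices 0 = i_0 ≤ i_1 ≤ … tending to infinity such
-- that p_{i_{j-1}+1},…,p_{i_j} fulfils r_j (r_{j+1} = r j).
InfContraction : (ℕ → ℕ) → (ℕ → ℕ) → Set
InfContraction r p =
  Σ (ℕ → ℕ) λ i →
    (i 0 ≡ 0) ×
    ((j : ℕ) → i j ≤ i (suc j)) ×
    ((N : ℕ) → ∃ λ j → N ≤ i j) ×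
    ((j : ℕ) → Fulfils (infixω p (i j) (i (suc j))) (r j))

-- Compose the index maps.  A block of π₂ that fulfils r is cut by the second
-- contraction into sub-blocks of π₃ whose concatenation is the composite
-- block of π₃.  Since the leader of a concatenation is the ⊔ of the leaders,
-- and s ⪯ a, t ⪯ b imply s ⊔ t ⪯ a ⊔ b, the leader of the π₂-block is
-- ⪯ the leader of the composite block, which therefore fulfils r too.
module Submission where

open import Defs
open import Data.Nat using (ℕ; zero; suc; _+_; _∸_; _≤_; _<_; _⊔_; z≤n; s≤s)
open import Data.Nat.Properties
open import Data.List using (List; []; _∷_; _++_; length; take; drop; applyUpTo; lookup)
open import Data.List.Properties using (map-upTo)
open import Data.List.Relation.Unary.All using (All)
open import Data.Fin using (Fin; toℕ; fromℕ<) renaming (zero to fzero; suc to fsuc)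
open import Data.Fin.Properties using (toℕ<n; toℕ-fromℕ<)
open import Data.Product using (Σ; ∃; _×_; _,_; proj₁; proj₂)
open import Data.Sum using (inj₁; inj₂)
open import Data.Empty using (⊥-elim)
open import Relation.Nullary using (¬_)
open import Relation.Binary.PropositionalEquality

odd⇒¬even : ∀ {n} → Odd n → ¬ Even n
odd⇒¬even o e with trans (sym o) e
... | ()

⪯-trans : ∀ {x y z} → x ⪯ y → y ⪯ z → x ⪯ z
⪯-trans         (odd⪯even ox _)     (even⪯even _ ez _)   = odd⪯even ox ez
⪯-trans         (odd⪯odd ox _ _)    (odd⪯even _ ez)      = odd⪯even ox ez
⪯-trans         (odd⪯odd ox _ y≤x)  (odd⪯odd _ oz z≤y)   = odd⪯odd ox oz (≤-trans z≤y y≤x)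
⪯-trans         (even⪯even ex _ x≤y) (even⪯even _ ez y≤z) = even⪯even ex ez (≤-trans x≤y y≤z)
⪯-trans {y = y} (odd⪯even _ ey)     (odd⪯even oy _)      = ⊥-elim (odd⇒¬even {y} oy ey)
⪯-trans {y = y} (odd⪯even _ ey)     (odd⪯odd oy _ _)     = ⊥-elim (odd⇒¬even {y} oy ey)
⪯-trans {y = y} (odd⪯odd _ oy _)    (even⪯even ey _ _)   = ⊥-elim (odd⇒¬even {y} oy ey)
⪯-trans {y = y} (even⪯even _ ey _)  (odd⪯even oy _)      = ⊥-elim (odd⇒¬even {y} oy ey)
⪯-trans {y = y} (even⪯even _ ey _)  (odd⪯odd oy _ _)     = ⊥-elim (odd⇒¬even {y} oy ey)

1⪯1 : 1 ⪯ 1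
1⪯1 = odd⪯odd refl refl ≤-refl

odd-≤-⪯ : ∀ {s t a} → Odd t → s ≤ t → s ⪯ a → t ⪯ a
odd-≤-⪯ ot s≤t (odd⪯even _ ea)     = odd⪯even ot ea
odd-≤-⪯ ot s≤t (odd⪯odd _ oa a≤s)  = odd⪯odd ot oa (≤-trans a≤s s≤t)
odd-≤-⪯ ot s≤t (even⪯even _ ea _)  = odd⪯even ot ea

⪯-cross : ∀ {s t a b} → s ≤ t → b ≤ a → s ⪯ a → t ⪯ b → t ⪯ a
⪯-cross s≤t b≤a s⪯a (odd⪯even ot _)   = odd-≤-⪯ ot s≤t s⪯a
⪯-cross s≤t b≤a s⪯a (odd⪯odd ot _ _)  = odd-≤-⪯ ot s≤t s⪯a
⪯-cross s≤t b≤a (odd⪯even _ ea) (even⪯even et _ t≤b)  = even⪯even et ea (≤-trans t≤b b≤a)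
⪯-cross s≤t b≤a (even⪯even _ ea _) (even⪯even et _ t≤b) = even⪯even et ea (≤-trans t≤b b≤a)
⪯-cross {a = a} s≤t b≤a (odd⪯odd _ oa a≤s) (even⪯even _ eb t≤b) =
  ⊥-elim (odd⇒¬even {a} oa (subst Even (≤-antisym b≤a (≤-trans a≤s (≤-trans s≤t t≤b))) eb))

⪯-⊔ : ∀ {s t a b} → s ⪯ a → t ⪯ b → (s ⊔ t) ⪯ (a ⊔ b)
⪯-⊔ {s} {t} {a} {b} s⪯a t⪯b with ≤-total s t | ≤-total b a
... | inj₁ s≤t | inj₁ b≤a rewrite m≤n⇒m⊔n≡n s≤t | m≥n⇒m⊔n≡m b≤a = ⪯-cross s≤t b≤a s⪯a t⪯b
... | inj₁ s≤t | inj₂ a≤b rewrite m≤n⇒m⊔n≡n s≤t | m≤n⇒m⊔n≡n a≤b = t⪯b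
... | inj₂ t≤s | inj₁ b≤a rewrite m≥n⇒m⊔n≡m t≤s | m≥n⇒m⊔n≡m b≤a = s⪯a
... | inj₂ t≤s | inj₂ a≤b rewrite m≥n⇒m⊔n≡m t≤s | m≤n⇒m⊔n≡n a≤b = ⪯-cross t≤s a≤b t⪯b s⪯a

1≤leader : ∀ xs → 1 ≤ leader xs
1≤leader []       = ≤-refl
1≤leader (x ∷ xs) = m≤n⇒m≤o⊔n x (1≤leader xs)

leader-++ : ∀ xs ys → leader (xs ++ ys) ≡ leader xs ⊔ leader ys
leader-++ []       ys = sym (m≤n⇒m⊔n≡n (1≤leader ys))
leader-++ (x ∷ xs) ys = trans (cong (x ⊔_) (leader-++ xs ys)) (sym (⊔-assoc x (leader xs) (leader ys)))

applyUpTo-cong : ∀ {f g : ℕ → ℕ} → (∀ k → f k ≡ g k) → ∀ n → applyUpTo f n ≡ applyUpTo g n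
applyUpTo-cong f≗g zero    = refl
applyUpTo-cong f≗g (suc n) = cong₂ _∷_ (f≗g 0) (applyUpTo-cong (λ k → f≗g (suc k)) n)

applyUpTo-++ : ∀ (f : ℕ → ℕ) m n → applyUpTo f (m + n) ≡ applyUpTo f m ++ applyUpTo (λ k → f (m + k)) n
applyUpTo-++ f zero    n = refl
applyUpTo-++ f (suc m) n = cong (f 0 ∷_) (applyUpTo-++ (λ k → f (suc k)) m n)

drop-applyUpTo : ∀ (f : ℕ → ℕ) {a n} → a ≤ n → drop a (applyUpTo f n) ≡ applyUpTo (λ k → f (a + k)) (n ∸ a)
drop-applyUpTo f z≤n       = refl
drop-applyUpTo f (s≤s a≤n) = drop-applyUpTo (λ k → f (suc k)) a≤n

infixω-++ : ∀ q {x y z} → x ≤ y → y ≤ z → infixω q x z ≡ infixω q x y ++ infixω q y z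
infixω-++ q {x} {y} {z} x≤y y≤z = begin
  infixω q x z                                         ≡⟨ map-upTo _ (z ∸ x) ⟩
  applyUpTo (λ k → q (x + k)) (z ∸ x)                  ≡⟨ cong (applyUpTo _) z∸x≡ ⟩
  applyUpTo (λ k → q (x + k)) ((y ∸ x) + (z ∸ y))      ≡⟨ applyUpTo-++ _ (y ∸ x) (z ∸ y) ⟩
  applyUpTo (λ k → q (x + k)) (y ∸ x) ++
    applyUpTo (λ k → q (x + (y ∸ x + k))) (z ∸ y)      ≡⟨ cong (_ ++_) (applyUpTo-cong x+[y∸x+k]≡y+k (z ∸ y)) ⟩
  applyUpTo (λ k → q (x + k)) (y ∸ x) ++
    applyUpTo (λ k → q (y + k)) (z ∸ y)                ≡⟨ sym (cong₂ _++_ (map-upTo _ (y ∸ x)) (map-upTo _ (z ∸ y))) ⟩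
  infixω q x y ++ infixω q y z                         ∎
  where
  open ≡-Reasoning
  z∸x≡ : z ∸ x ≡ (y ∸ x) + (z ∸ y)
  z∸x≡ = trans (cong (_∸ x) (sym (m∸n+n≡m y≤z)))
               (trans (+-∸-assoc (z ∸ y) x≤y) (+-comm (z ∸ y) (y ∸ x)))
  x+[y∸x+k]≡y+k : ∀ k → q (x + (y ∸ x + k)) ≡ q (y + k)
  x+[y∸x+k]≡y+k k = cong q (trans (sym (+-assoc x (y ∸ x) k)) (cong (_+ k) (m+[n∸m]≡n x≤y)))

-- nth xs k is 0 when k is out of range; it is only ever used within range.
nth : List ℕ → ℕ → ℕ
nth []       _       = 0
nth (x ∷ xs) zero    = x
nth (x ∷ xs) (suc k) = nth xs k

lookup≡nth : ∀ xs (j : Fin (length xs)) → lookup xs j ≡ nth xs (toℕ j)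
lookup≡nth (x ∷ xs) fzero    = refl
lookup≡nth (x ∷ xs) (fsuc j) = lookup≡nth xs j

take≡applyUpTo-nth : ∀ xs {b} → b ≤ length xs → take b xs ≡ applyUpTo (nth xs) b
take≡applyUpTo-nth xs       {zero}  _         = refl
take≡applyUpTo-nth (x ∷ xs) {suc b} (s≤s b≤n) = cong (x ∷_) (take≡applyUpTo-nth xs b≤n)

infixL≡infixω-nth : ∀ xs {a b} → a ≤ b → b ≤ length xs → infixL xs a b ≡ infixω (nth xs) a b
infixL≡infixω-nth xs {a} {b} a≤b b≤n =
  trans (cong (drop a) (take≡applyUpTo-nth xs b≤n))
        (trans (drop-applyUpTo (nth xs) a≤b) (sym (map-upTo _ (b ∸ a))))

record Contracts (k : ℕ) (i r p : ℕ → ℕ) : Set where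
  constructor contracts
  field
    block : ∀ j → j < k → i j ≤ i (suc j) × Fulfils (infixω p (i j) (i (suc j))) (r j)

open Contracts

Contracts-≤ : ∀ {m n i r p} → m ≤ n → Contracts n i r p → Contracts m i r p
Contracts-≤ m≤n c = contracts λ j j<m → block c j (≤-trans j<m m≤n)

Contracts-drop : ∀ {n i r p} a → a ≤ n → Contracts n i r p →
  Contracts (n ∸ a) (λ k → i (a + k)) (λ k → r (a + k)) p
Contracts-drop {n} {i} {r} {p} a a≤n c = contracts drop-block
  where
  a+j<n : ∀ j → j < n ∸ a → a + j < n
  a+j<n j j<n∸a = subst (a + j <_) (m+[n∸m]≡n a≤n) (+-monoʳ-< a j<n∸a)
  drop-block : ∀ j → j < n ∸ a → i (a + j) ≤ i (a + suc j) ×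
    Fulfils (infixω p (i (a + j)) (i (a + suc j))) (r (a + j))
  drop-block j j<n∸a rewrite +-suc a j = block c (a + j) (a+j<n j j<n∸a)

stepwise-mono : ∀ (g : ℕ → ℕ) {n} → (∀ j → j < n → g j ≤ g (suc j)) →
  ∀ {x y} → x ≤ y → y ≤ n → g x ≤ g y
stepwise-mono g step {y = zero}  z≤n  _ = ≤-refl
stepwise-mono g step {x} {suc y} x≤1+y 1+y≤n with m≤n⇒m<n∨m≡n x≤1+y
... | inj₂ refl      = ≤-refl
... | inj₁ (s≤s x≤y) = ≤-trans (stepwise-mono g step x≤y (≤-trans (n≤1+n y) 1+y≤n)) (step y 1+y≤n)

Contracts-mono : ∀ {n i r p} → Contracts n i r p → ∀ {x y} → x ≤ y → y ≤ n → i x ≤ i y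
Contracts-mono {i = i} c = stepwise-mono i (λ j j<n → proj₁ (block c j j<n))

leader-⪯-Contracts : ∀ n {g p q} → Contracts n g p q →
  leader (applyUpTo p n) ⪯ leader (infixω q (g 0) (g n))
leader-⪯-Contracts zero {g} c rewrite n∸n≡0 (g 0) = 1⪯1
leader-⪯-Contracts (suc n) {g} {p} {q} c
  rewrite infixω-++ q (proj₁ (block c 0 (s≤s z≤n))) (Contracts-mono c (s≤s z≤n) ≤-refl)
        | leader-++ (infixω q (g 0) (g 1)) (infixω q (g 1) (g (suc n))) =
  ⪯-⊔ (proj₂ (block c 0 (s≤s z≤n))) (leader-⪯-Contracts n (Contracts-drop 1 (s≤s z≤n) c))

Fulfils-Contracts : ∀ {a b g p q r} → a ≤ b → Contracts b g p q →
  Fulfils (infixω p a b) r → Fulfils (infixω q (g a) (g b)) r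
Fulfils-Contracts {a} {b} {g} {p} {q} a≤b c r⪯ = ⪯-trans r⪯
  (subst₂ (λ u v → leader u ⪯ leader v)
     (sym (map-upTo _ (b ∸ a)))
     (cong₂ (infixω q) (cong g (+-identityʳ a)) (cong g (m+[n∸m]≡n a≤b)))
     (leader-⪯-Contracts (b ∸ a) (Contracts-drop a a≤b c)))

Contracts-trans : ∀ {k i i′ r p q} → Contracts k i r p → Contracts (i k) i′ p q →
  Contracts k (λ j → i′ (i j)) r q
Contracts-trans {i = i} {i′} c c′ = contracts λ j j<k →
  let i[j]≤i[1+j] = proj₁ (block c j j<k)
      i[1+j]≤i[k] = Contracts-mono c j<k ≤-refl
  in Contracts-mono c′ i[j]≤i[1+j] i[1+j]≤i[k] ,
     Fulfils-Contracts i[j]≤i[1+j] (Contracts-≤ i[1+j]≤i[k] c′) (proj₂ (block c j j<k))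

FinContraction′ : List ℕ → List ℕ → Set
FinContraction′ rs ps = Σ (ℕ → ℕ) λ i →
  i 0 ≡ 0 × i (length rs) ≡ length ps × Contracts (length rs) i (nth rs) (nth ps)

FinContraction⇒FinContraction′ : ∀ {rs ps} → FinContraction rs ps → FinContraction′ rs ps
FinContraction⇒FinContraction′ {rs} {ps} (i , i0 , ik , step , fulfils) =
  i , i0 , ik , contracts λ j j<k →
    step j j<k , subst (λ j → Fulfils (infixω (nth ps) (i j) (i (suc j))) (nth rs j))
                       (toℕ-fromℕ< j<k) (fulfils-nth (fromℕ< j<k))
  where
  fulfils-nth : (j : Fin (length rs)) →
    Fulfils (infixω (nth ps) (i (toℕ j)) (i (suc (toℕ j)))) (nth rs (toℕ j))
  fulfils-nth j = subst₂ (λ r xs → Fulfils xs r) (lookup≡nth rs j)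
    (infixL≡infixω-nth ps (step (toℕ j) (toℕ<n j))
       (subst (i (suc (toℕ j)) ≤_) ik (stepwise-mono i step (toℕ<n j) ≤-refl)))
    (fulfils j)

FinContraction′⇒FinContraction : ∀ {rs ps} → FinContraction′ rs ps → FinContraction rs ps
FinContraction′⇒FinContraction {rs} {ps} (i , i0 , ik , c) =
  i , i0 , ik , (λ j j<k → proj₁ (block c j j<k)) , λ j →
    subst₂ (λ r xs → Fulfils xs r) (sym (lookup≡nth rs j))
      (sym (infixL≡infixω-nth ps (proj₁ (block c (toℕ j) (toℕ<n j)))
              (subst (i (suc (toℕ j)) ≤_) ik (Contracts-mono c (toℕ<n j) ≤-refl))))
      (proj₂ (block c (toℕ j) (toℕ<n j)))

FinContraction-trans : ∀ {π₁ π₂ π₃} → FinContraction π₁ π₂ → FinContraction π₂ π₃ → FinContraction π₁ π₃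
FinContraction-trans {π₁} {π₂} {π₃} c₁₂ c₂₃
  with FinContraction⇒FinContraction′ {π₁} {π₂} c₁₂ | FinContraction⇒FinContraction′ {π₂} {π₃} c₂₃
... | i , i0 , ik , c | i′ , i′0 , i′k , c′ =
  FinContraction′⇒FinContraction {π₁} {π₃}
    ((λ j → i′ (i j)) , trans (cong i′ i0) i′0 , trans (cong i′ ik) i′k ,
     Contracts-trans c (subst (λ n → Contracts n i′ (nth π₂) (nth π₃)) (sym ik) c′))

InfContraction-trans : ∀ {π₁ π₂ π₃} → InfContraction π₁ π₂ → InfContraction π₂ π₃ → InfContraction π₁ π₃
InfContraction-trans {π₁} {π₂} {π₃}
  (i , i0 , step , unbounded , fulfils) (i′ , i′0 , step′ , unbounded′ , fulfils′) =
  (λ j → i′ (i j)) , trans (cong i′ i0) i′0 ,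
  (λ j → proj₁ (composite-block j)) , composite-unbounded , (λ j → proj₂ (composite-block j))
  where
  c : ∀ k → Contracts k i π₁ π₂
  c k = contracts λ j _ → step j , fulfils j
  c′ : ∀ k → Contracts k i′ π₂ π₃
  c′ k = contracts λ j _ → step′ j , fulfils′ j
  composite-block : ∀ j → i′ (i j) ≤ i′ (i (suc j)) ×
    Fulfils (infixω π₃ (i′ (i j)) (i′ (i (suc j)))) (π₁ j)
  composite-block j = block (Contracts-trans (c (suc j)) (c′ (i (suc j)))) j (n<1+n j)
  composite-unbounded : ∀ N → ∃ λ j → N ≤ i′ (i j)
  composite-unbounded N with unbounded′ N
  ... | j′ , N≤i′[j′] with unbounded j′
  ... | j , j′≤i[j] = j , ≤-trans N≤i′[j′] (Contracts-mono (c′ (i j)) j′≤i[j] ≤-refl)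

lemma5p4 : (d : ℕ) → 1 ≤ d →
    ((π₁ π₂ π₃ : List ℕ) →
    All (Prio d) π₁ → All (Prio d) π₂ → All (Prio d) π₃ →
    FinContraction π₁ π₂ → FinContraction π₂ π₃ → FinContraction π₁ π₃)
    ×
    ((π₁ π₂ π₃ : ℕ → ℕ) →
    (∀ m → Prio d (π₁ m)) → (∀ m → Prio d (π₂ m)) → (∀ m → Prio d (π₃ m)) →
    InfContraction π₁ π₂ → InfContraction π₂ π₃ → InfContraction π₁ π₃)
lemma5p4 _ _ = (λ π₁ π₂ π₃ _ _ _ → FinContraction-trans {π₁} {π₂} {π₃})
              , (λ π₁ π₂ π₃ _ _ _ → InfContraction-trans {π₁} {π₂} {π₃})
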